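{- Let $G\in\mathcal E$ and let $k=\operatorname{rank}(G)\geq 1$. Then $\hat o_L(G)=\min\{o_L(G),\,o_L(G+M_{k-1})\}$ and $\hat o_R(G)=\max\{o_R(G),\,o_R(G+\overline{M_{k-1}})\}$.
   Context: All games are short two-player partizan games between Left and Right, identified with their game trees: $G=\{G^{\mathcal L}\mid G^{\mathcal R}\}$ with finite sets of options. Followers of $G$: $G$, its options, their options, etc. Rank of $G$: height of its game tree; $\mathbf 0=\{\;\mid\;\}$. Disjunctive sum: $G+H=\{G^{\mathcal L}+H,G+H^{\mathcal L}\mid G^{\mathcal R}+H,G+H^{\mathcal R}\}$. Conjugate: $\overline G=\{\overline{G^{\mathcal R}}\mid\overline{G^{\mathcal L}}\}$ (recursively). Misère play: a player with no move on their turn wins. $o_L(G)=\mathrm L$ if $G^{\mathcal L}=\emptyset$, else $\max_{G^L}o_R(G^L)$; $o_R(G)=\mathrm R$ if $G^{\mathcal R}=\emptyset$, else $\min_{G^R}o_L(G^R)$; $\mathrm L>\mathrm R$. A Left-end has no Left option; a dead Left-end has only Left-ends as followers; similarly Right. A game is dead-ending if each follower that is a Left-end (Right-end) is a dead Left-end (dead Right-end); $\mathcal E$ is the class of dead-ending games. Strong outcomes of $G\in\mathcal E$: $\hat o_L(G)=\min\{o_L(G+X): X\in\mathcal E \text{ a Left-end}\}$ and $\hat o_R(G)=\max\{o_R(G+Y): Y\in\mathcal E\text{ a Right-end}\}$. Perfect murders: $M_0=\mathbf 0$, $M_n=\{\;\mid\mathbf 0,M_{n-1}\}$ for $n>0$.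 -}

module Defs where

open import Data.Nat using (ℕ; zero; suc; _⊔_)
open import Data.List using (List; []; _∷_)
open import Data.List.Membership.Propositional using (_∈_)
open import Data.Product using (Σ; _×_)
open import Relation.Binary.PropositionalEquality using (_≡_)

data Game : Set where
  mk : List Game → List Game → Game

leftOpts : Game → List Game
leftOpts (mk GL _) = GL

rightOpts : Game → List Game
rightOpts (mk _ GR) = GR

𝟎 : Game
𝟎 = mk [] []

-- Misère outcomes, with R < L.
data Outcome : Set where
  R L : Outcome

data _≤O_ : Outcome → Outcome → Set where
  R≤ : ∀ {o} → R ≤O o
  L≤L : L ≤O L

maxO : Outcome → Outcome → Outcome
maxO L _ = L
maxO R o = o

minO : Outcome → Outcome → Outcome
minO R _ = R
minO L o = o

mutual
  oL : Game → Outcome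
  oL (mk [] _) = L
  oL (mk (g ∷ gs) _) = maxOR (g ∷ gs)

  oR : Game → Outcome
  oR (mk _ []) = R
  oR (mk _ (g ∷ gs)) = minOL (g ∷ gs)

  -- max over the list of o_R values (empty list never used at top level)
  maxOR : List Game → Outcome
  maxOR [] = R
  maxOR (g ∷ gs) = maxO (oR g) (maxOR gs)

  minOL : List Game → Outcome
  minOL [] = L
  minOL (g ∷ gs) = minO (oL g) (minOL gs)

mutual
  _+G_ : Game → Game → Game
  G@(mk GL GR) +G H@(mk HL HR) =
    mk (addL GL H ++G addR G HL) (addL GR H ++G addR G HR)

  addL : List Game → Game → List Game
  addL [] H = []
  addL (g ∷ gs) H = (g +G H) ∷ addL gs H

  addR : Game → List Game → List Game
  addR G [] = []
  addR G (h ∷ hs) = (G +G h) ∷ addR G hs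

  _++G_ : List Game → List Game → List Game
  [] ++G ys = ys
  (x ∷ xs) ++G ys = x ∷ (xs ++G ys)

infixl 6 _+G_

mutual
  conj : Game → Game
  conj (mk GL GR) = mk (conjList GR) (conjList GL)

  conjList : List Game → List Game
  conjList [] = []
  conjList (g ∷ gs) = conj g ∷ conjList gs

mutual
  rank : Game → ℕ
  rank (mk [] []) = 0
  rank (mk GL GR) = suc (rankList GL ⊔ rankList GR)

  rankList : List Game → ℕ
  rankList [] = 0
  rankList (g ∷ gs) = rank g ⊔ rankList gs

data Follower : Game → Game → Set where
  self   : ∀ {G} → Follower G G
  viaL   : ∀ {H g GL GR} → g ∈ GL → Follower H g → Follower H (mk GL GR)
  viaR   : ∀ {H g GL GR} → g ∈ GR → Follower H g → Follower H (mk GL GR)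

IsLeftEnd : Game → Set
IsLeftEnd G = leftOpts G ≡ []

IsRightEnd : Game → Set
IsRightEnd G = rightOpts G ≡ []

DeadLeftEnd : Game → Set
DeadLeftEnd G = ∀ H → Follower H G → IsLeftEnd H

DeadRightEnd : Game → Set
DeadRightEnd G = ∀ H → Follower H G → IsRightEnd H

DeadEnding : Game → Set
DeadEnding G = ∀ H → Follower H G →
  (IsLeftEnd H → DeadLeftEnd H) × (IsRightEnd H → DeadRightEnd H)

-- "o is the strong Left outcome of G": o is the minimum of
-- { o_L(G+X) : X ∈ 𝓔 a Left-end }  (a lower bound that is attained).
IsHatOL : Game → Outcome → Set
IsHatOL G o =
  ((X : Game) → DeadEnding X → IsLeftEnd X → o ≤O oL (G +G X)) ×
  Σ Game (λ X → DeadEnding X × IsLeftEnd X × oL (G +G X) ≡ o)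

-- "o is the strong Right outcome of G": o is the maximum of
-- { o_R(G+Y) : Y ∈ 𝓔 a Right-end }.
IsHatOR : Game → Outcome → Set
IsHatOR G o =
  ((Y : Game) → DeadEnding Y → IsRightEnd Y → oR (G +G Y) ≤O o) ×
  Σ Game (λ Y → DeadEnding Y × IsRightEnd Y × oR (G +G Y) ≡ o)

M : ℕ → Game
M zero = 𝟎
M (suc n) = mk [] (𝟎 ∷ M n ∷ [])

module Submission where

-- A Left-end test game X in 𝓔 is a dead Left-end, hence either 𝟎 or a dead
-- Left-end with some Right move.  Against a game G with rank G ≤ j + 1 the
-- perfect murder M_j is at least as good for Right as any such nonzero X:
-- every Right reply in G + X is copied in G + M_j, a reply X → x becoming
-- M_j → 𝟎 when x = 𝟎 and M_j → M_(j-1) otherwise (murder-oL / murder-oR, a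
-- mutual induction on the rank of G).  Since G + 𝟎 = G this yields
-- ô_L(G) = min(o_L(G), o_L(G + M_j))  (strongLeftOutcome).
-- The Right half follows by symmetry: conjugation exchanges the players, is
-- an involution, distributes over sums, preserves rank and dead-ending games,
-- and turns o_L into the reversed o_R  (strongOutcome-conj).

open import Defs
open import Data.Nat using (ℕ; zero; suc; _≤_; _<_; _∸_; _⊔_; s≤s)
open import Data.Nat.Properties
  using (≤-trans; ≤-pred; <-≤-trans; m<n⇒m≤1+n; m≤m⊔n; m≤n⊔m; ⊔-comm; ⊔-identityʳ; m≤n+m∸n; n≮0)
open import Data.Nat.Induction using (<-wellFounded)
open import Induction.WellFounded using (Acc; acc)
open import Data.List using (List; []; _∷_; _++_; map)
open import Data.List.Properties using (++-identityʳ)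
open import Data.List.Membership.Propositional using (_∈_)
open import Data.List.Membership.Propositional.Properties using (∈-map⁺; ∈-map⁻; ∈-++⁺ˡ; ∈-++⁺ʳ; ∈-++⁻)
open import Data.List.Relation.Unary.Any using (here; there)
open import Data.Product using (Σ; ∃; _×_; _,_; proj₁)
open import Data.Sum using (_⊎_; inj₁; inj₂)
open import Data.Empty using (⊥; ⊥-elim)
open import Relation.Binary.PropositionalEquality
  using (_≡_; refl; sym; trans; cong; cong₂; subst; module ≡-Reasoning)

private
  variable
    G H X g h x : Game
    gs : List Game

flipO : Outcome → Outcome
flipO L = R
flipO R = L

flipO-involutive : ∀ o → flipO (flipO o) ≡ o
flipO-involutive L = refl
flipO-involutive R = refl

flipO-minO : ∀ a b → flipO (minO a b) ≡ maxO (flipO a) (flipO b)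
flipO-minO L b = refl
flipO-minO R b = refl

flipO-maxO : ∀ a b → flipO (maxO a b) ≡ minO (flipO a) (flipO b)
flipO-maxO L b = refl
flipO-maxO R b = refl

flipO-antitone : ∀ {a b} → a ≤O b → flipO b ≤O flipO a
flipO-antitone {b = L} R≤ = R≤
flipO-antitone {b = R} R≤ = L≤L
flipO-antitone L≤L = R≤

≤O-fromR : ∀ {o} o' → (o' ≡ R → o ≡ R) → o ≤O o'
≤O-fromR {R} o' forced = R≤
≤O-fromR {L} L forced = L≤L
≤O-fromR {L} R forced with forced refl
... | ()

minO-Rˡ : ∀ {a} b → a ≡ R → minO a b ≡ R
minO-Rˡ b refl = refl

minO-Rʳ : ∀ a {b} → b ≡ R → minO a b ≡ R
minO-Rʳ L refl = refl
minO-Rʳ R refl = refl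

maxOR≡R⁻ : ∀ gs → maxOR gs ≡ R → g ∈ gs → oR g ≡ R
maxOR≡R⁻ (g ∷ gs) e m with oR g in eq
maxOR≡R⁻ (g ∷ gs) e (here refl) | R = eq
maxOR≡R⁻ (g ∷ gs) e (there m)   | R = maxOR≡R⁻ gs e m

maxOR≡R⁺ : ∀ gs → (∀ {g} → g ∈ gs → oR g ≡ R) → maxOR gs ≡ R
maxOR≡R⁺ []       all = refl
maxOR≡R⁺ (g ∷ gs) all rewrite all (here refl) = maxOR≡R⁺ gs (λ m → all (there m))

minOL≡R⁻ : ∀ gs → minOL gs ≡ R → ∃ λ g → g ∈ gs × oL g ≡ R
minOL≡R⁻ (g ∷ gs) e with oL g in eq
... | R = g , here refl , eq
... | L with minOL≡R⁻ gs e
...   | g' , m , e' = g' , there m , e'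

minOL≡R⁺ : ∀ gs → g ∈ gs → oL g ≡ R → minOL gs ≡ R
minOL≡R⁺ (g ∷ gs) (here refl) e = minO-Rˡ (minOL gs) e
minOL≡R⁺ (g ∷ gs) (there m)   e = minO-Rʳ (oL g) (minOL≡R⁺ gs m e)

oL≡R⁻ : ∀ G → oL G ≡ R →
        (∃ λ g → g ∈ leftOpts G) × (∀ {g} → g ∈ leftOpts G → oR g ≡ R)
oL≡R⁻ (mk (g ∷ gs) _) e = (g , here refl) , maxOR≡R⁻ (g ∷ gs) e

oL≡R⁺ : ∀ G → g ∈ leftOpts G → (∀ {g} → g ∈ leftOpts G → oR g ≡ R) → oL G ≡ R
oL≡R⁺ (mk (g ∷ gs) _) _ all = maxOR≡R⁺ (g ∷ gs) all

oR≡R⁻ : ∀ G → oR G ≡ R → rightOpts G ≡ [] ⊎ (∃ λ g → g ∈ rightOpts G × oL g ≡ R)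
oR≡R⁻ (mk _ [])       e = inj₁ refl
oR≡R⁻ (mk _ (g ∷ gs)) e = inj₂ (minOL≡R⁻ (g ∷ gs) e)

oR≡R⁺ : ∀ G → g ∈ rightOpts G → oL g ≡ R → oR G ≡ R
oR≡R⁺ (mk _ (g ∷ gs)) m e = minOL≡R⁺ (g ∷ gs) m e

++G≡++ : ∀ (xs ys : List Game) → xs ++G ys ≡ xs ++ ys
++G≡++ []       ys = refl
++G≡++ (x ∷ xs) ys = cong (x ∷_) (++G≡++ xs ys)

addL≡map : ∀ gs H → addL gs H ≡ map (_+G H) gs
addL≡map []       H = refl
addL≡map (g ∷ gs) H = cong (g +G H ∷_) (addL≡map gs H)

addR≡map : ∀ G hs → addR G hs ≡ map (G +G_) hs
addR≡map G []       = refl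
addR≡map G (h ∷ hs) = cong (G +G h ∷_) (addR≡map G hs)

∉[] : gs ≡ [] → g ∈ gs → ⊥
∉[] refl ()

leftOpts-+ : ∀ G H → leftOpts (G +G H) ≡ map (_+G H) (leftOpts G) ++ map (G +G_) (leftOpts H)
leftOpts-+ G@(mk GL _) H@(mk HL _) =
  trans (++G≡++ (addL GL H) (addR G HL)) (cong₂ _++_ (addL≡map GL H) (addR≡map G HL))

rightOpts-+ : ∀ G H → rightOpts (G +G H) ≡ map (_+G H) (rightOpts G) ++ map (G +G_) (rightOpts H)
rightOpts-+ G@(mk _ GR) H@(mk _ HR) =
  trans (++G≡++ (addL GR H) (addR G HR)) (cong₂ _++_ (addL≡map GR H) (addR≡map G HR))

∈leftOpts-+⁻ : ∀ G H → IsLeftEnd H → h ∈ leftOpts (G +G H) → ∃ λ g → g ∈ leftOpts G × h ≡ g +G H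
∈leftOpts-+⁻ G H noMove m
  rewrite leftOpts-+ G H | noMove | ++-identityʳ (map (_+G H) (leftOpts G)) = ∈-map⁻ (_+G H) m

∈leftOpts-+ˡ : ∀ G H → g ∈ leftOpts G → g +G H ∈ leftOpts (G +G H)
∈leftOpts-+ˡ G H m rewrite leftOpts-+ G H = ∈-++⁺ˡ (∈-map⁺ (_+G H) m)

∈rightOpts-+⁻ : ∀ G H → h ∈ rightOpts (G +G H) →
  (∃ λ g → g ∈ rightOpts G × h ≡ g +G H) ⊎ (∃ λ x → x ∈ rightOpts H × h ≡ G +G x)
∈rightOpts-+⁻ G H m rewrite rightOpts-+ G H
  with ∈-++⁻ (map (_+G H) (rightOpts G)) m
... | inj₁ inG = inj₁ (∈-map⁻ (_+G H) inG)
... | inj₂ inH = inj₂ (∈-map⁻ (G +G_) inH)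

∈rightOpts-+ˡ : ∀ G H → g ∈ rightOpts G → g +G H ∈ rightOpts (G +G H)
∈rightOpts-+ˡ G H m rewrite rightOpts-+ G H = ∈-++⁺ˡ (∈-map⁺ (_+G H) m)

∈rightOpts-+ʳ : ∀ G H → x ∈ rightOpts H → G +G x ∈ rightOpts (G +G H)
∈rightOpts-+ʳ G H m rewrite rightOpts-+ G H =
  ∈-++⁺ʳ (map (_+G H) (rightOpts G)) (∈-map⁺ (G +G_) m)

oL-+leftEnd≡R⁻ : ∀ G H → IsLeftEnd H → oL (G +G H) ≡ R →
  (∃ λ g → g ∈ leftOpts G) × (∀ {g} → g ∈ leftOpts G → oR (g +G H) ≡ R)
oL-+leftEnd≡R⁻ G H noMove lose with oL≡R⁻ (G +G H) lose
... | (h , hm) , allLose with ∈leftOpts-+⁻ G H noMove hm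
...   | g , gm , _ = (g , gm) , λ g'm → allLose (∈leftOpts-+ˡ G H g'm)

oL-+leftEnd≡R⁺ : ∀ G H → IsLeftEnd H → g ∈ leftOpts G →
  (∀ {g} → g ∈ leftOpts G → oR (g +G H) ≡ R) → oL (G +G H) ≡ R
oL-+leftEnd≡R⁺ G H noMove gm allLose = oL≡R⁺ (G +G H) (∈leftOpts-+ˡ G H gm) λ hm →
  case-move (∈leftOpts-+⁻ G H noMove hm)
  where
  case-move : ∀ {h} → (∃ λ g → g ∈ leftOpts G × h ≡ g +G H) → oR h ≡ R
  case-move (g , g∈ , refl) = allLose g∈

mutual
  +G-identityʳ : ∀ G → G +G 𝟎 ≡ G
  +G-identityʳ (mk GL GR) = cong₂ mk (addL-𝟎 GL) (addL-𝟎 GR)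

  addL-𝟎 : ∀ gs → addL gs 𝟎 ++G [] ≡ gs
  addL-𝟎 []       = refl
  addL-𝟎 (g ∷ gs) = cong₂ _∷_ (+G-identityʳ g) (addL-𝟎 gs)

rank≤rankList : g ∈ gs → rank g ≤ rankList gs
rank≤rankList {gs = g ∷ gs} (here refl) = m≤m⊔n (rank g) (rankList gs)
rank≤rankList {gs = g ∷ gs} (there m)   = ≤-trans (rank≤rankList m) (m≤n⊔m (rank g) (rankList gs))

rank-leftOpt< : g ∈ leftOpts G → rank g < rank G
rank-leftOpt< {G = mk (g ∷ gs) GR} m = s≤s (≤-trans (rank≤rankList m) (m≤m⊔n _ (rankList GR)))

rank-rightOpt< : g ∈ rightOpts G → rank g < rank G
rank-rightOpt< {G = mk [] (g ∷ gs)}      m = s≤s (rank≤rankList m)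
rank-rightOpt< {G = mk (x ∷ xs) (g ∷ gs)} m =
  s≤s (≤-trans (rank≤rankList m) (m≤n⊔m (rankList (x ∷ xs)) _))

followerTrans : Follower g h → Follower h G → Follower g G
followerTrans f self        = f
followerTrans f (viaL m f') = viaL m (followerTrans f f')
followerTrans f (viaR m f') = viaR m (followerTrans f f')

leftEnd : DeadLeftEnd X → IsLeftEnd X
leftEnd dead = dead _ self

deadLeftEnd-rightOpt : DeadLeftEnd X → x ∈ rightOpts X → DeadLeftEnd x
deadLeftEnd-rightOpt {mk _ _} dead m H f = dead H (viaR m f)

deadLeftEnd-intro : ∀ {XR} → (∀ {x} → x ∈ XR → DeadLeftEnd x) → DeadLeftEnd (mk [] XR)
deadLeftEnd-intro dead H self       = refl
deadLeftEnd-intro dead H (viaL () _)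
deadLeftEnd-intro dead H (viaR m f) = dead m H f

M-deadLeftEnd : ∀ j → DeadLeftEnd (M j)
M-deadLeftEnd zero    = deadLeftEnd-intro λ ()
M-deadLeftEnd (suc j) = deadLeftEnd-intro λ where
  (here refl)         → M-deadLeftEnd zero
  (there (here refl)) → M-deadLeftEnd j

deadLeftEnd-cases : DeadLeftEnd X → X ≡ 𝟎 ⊎ ∃ λ x → x ∈ rightOpts X
deadLeftEnd-cases {mk _ []} dead with leftEnd dead
... | refl = inj₁ refl
deadLeftEnd-cases {mk _ (x ∷ _)} dead = inj₂ (x , here refl)

𝟎-deadRightEnd : DeadRightEnd 𝟎
𝟎-deadRightEnd _ self        = refl
𝟎-deadRightEnd _ (viaL () _)
𝟎-deadRightEnd _ (viaR () _)

-- Every dead Left-end is dead-ending: its followers are dead Left-ends, and a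
-- follower that is also a Right-end has no options at all, i.e. is 𝟎.
deadLeftEnd⇒deadEnding : DeadLeftEnd X → DeadEnding X
deadLeftEnd⇒deadEnding dead H f =
  (λ _ H' f' → dead H' (followerTrans f' f)) , bothEnds (dead H f)
  where
  bothEnds : ∀ {H} → IsLeftEnd H → IsRightEnd H → DeadRightEnd H
  bothEnds {mk [] []} refl refl = 𝟎-deadRightEnd

mutual
  murder-oL : ∀ {j G X} → Acc _<_ (rank G) → rank G ≤ suc j →
              DeadLeftEnd X → (∃ λ x → x ∈ rightOpts X) →
              oL (G +G X) ≡ R → oL (G +G M j) ≡ R
  murder-oL {j} {G} {X} (acc smaller) rankG dead nonzero lose
    with oL-+leftEnd≡R⁻ G X (leftEnd dead) lose
  ... | (g , gm) , allLose =
    oL-+leftEnd≡R⁺ G (M j) (leftEnd (M-deadLeftEnd j)) gm λ g'm →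
      murder-oR (smaller (rank-leftOpt< g'm)) (≤-pred (≤-trans (rank-leftOpt< g'm) rankG))
        dead nonzero (allLose g'm)

  murder-oR : ∀ {j G X} → Acc _<_ (rank G) → rank G ≤ j →
              DeadLeftEnd X → (∃ λ x → x ∈ rightOpts X) →
              oR (G +G X) ≡ R → oR (G +G M j) ≡ R
  murder-oR {j} {G} {X} a@(acc smaller) rankG dead nonzero@(x , xm) win
    with oR≡R⁻ (G +G X) win
  ... | inj₁ noMove = ⊥-elim (∉[] noMove (∈rightOpts-+ʳ G X xm))
  ... | inj₂ (h , hm , hWin) with ∈rightOpts-+⁻ G X hm
  ...   | inj₁ (g , gm , refl) =
    oR≡R⁺ (G +G M j) (∈rightOpts-+ˡ G (M j) gm)
      (murder-oL (smaller (rank-rightOpt< gm)) (m<n⇒m≤1+n (<-≤-trans (rank-rightOpt< gm) rankG))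
        dead nonzero hWin)
  ...   | inj₂ (x' , x'm , refl) = murder-reply a rankG (deadLeftEnd-rightOpt dead x'm) hWin

  -- Right's answer to X → x: M_j → 𝟎 if x = 𝟎, M_j → M_(j-1) otherwise.
  murder-reply : ∀ {j G x} → Acc _<_ (rank G) → rank G ≤ j →
                 DeadLeftEnd x → oL (G +G x) ≡ R → oR (G +G M j) ≡ R
  murder-reply {zero} {G} {x} a rankG dead lose
    with oL-+leftEnd≡R⁻ G x (leftEnd dead) lose
  ... | (g , gm) , _ = ⊥-elim (n≮0 (<-≤-trans (rank-leftOpt< gm) rankG))
  murder-reply {suc j} {G} a rankG dead lose with deadLeftEnd-cases dead
  ... | inj₁ refl = oR≡R⁺ (G +G M (suc j)) (∈rightOpts-+ʳ G (M (suc j)) (here refl)) lose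
  ... | inj₂ nonzero =
    oR≡R⁺ (G +G M (suc j)) (∈rightOpts-+ʳ G (M (suc j)) (there (here refl))) (murder-oL a rankG dead nonzero lose)

strongLeftOutcome : ∀ G j → rank G ≤ suc j → IsHatOL G (minO (oL G) (oL (G +G M j)))
strongLeftOutcome G j rankG = lowerBound , attained
  where
  testLost : ∀ X → DeadLeftEnd X → oL (G +G X) ≡ R → minO (oL G) (oL (G +G M j)) ≡ R
  testLost X dead lose with deadLeftEnd-cases dead
  ... | inj₁ refl = minO-Rˡ _ (trans (cong oL (sym (+G-identityʳ G))) lose)
  ... | inj₂ nonzero = minO-Rʳ (oL G) (murder-oL (<-wellFounded (rank G)) rankG dead nonzero lose)

  lowerBound : ∀ X → DeadEnding X → IsLeftEnd X → minO (oL G) (oL (G +G M j)) ≤O oL (G +G X)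
  lowerBound X deadEnding noMove =
    ≤O-fromR (oL (G +G X)) (testLost X (proj₁ (deadEnding X self) noMove))

  attained : Σ Game λ X → DeadEnding X × IsLeftEnd X × oL (G +G X) ≡ minO (oL G) (oL (G +G M j))
  attained with oL G in e
  ... | R = 𝟎 , deadLeftEnd⇒deadEnding (M-deadLeftEnd 0) , refl , trans (cong oL (+G-identityʳ G)) e
  ... | L = M j , deadLeftEnd⇒deadEnding (M-deadLeftEnd j) , leftEnd (M-deadLeftEnd j) , refl

mutual
  conj-involutive : ∀ G → conj (conj G) ≡ G
  conj-involutive (mk GL GR) = cong₂ mk (conjList-involutive GL) (conjList-involutive GR)

  conjList-involutive : ∀ gs → conjList (conjList gs) ≡ gs
  conjList-involutive []       = refl
  conjList-involutive (g ∷ gs) = cong₂ _∷_ (conj-involutive g) (conjList-involutive gs)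

conjList-++G : ∀ xs ys → conjList (xs ++G ys) ≡ conjList xs ++G conjList ys
conjList-++G []       ys = refl
conjList-++G (x ∷ xs) ys = cong (conj x ∷_) (conjList-++G xs ys)

mutual
  conj-+ : ∀ G H → conj (G +G H) ≡ conj G +G conj H
  conj-+ G@(mk GL GR) H@(mk HL HR) =
    cong₂ mk (trans (conjList-++G (addL GR H) (addR G HR))
                    (cong₂ _++G_ (conjList-addL GR H) (conjList-addR G HR)))
             (trans (conjList-++G (addL GL H) (addR G HL))
                    (cong₂ _++G_ (conjList-addL GL H) (conjList-addR G HL)))

  conjList-addL : ∀ gs H → conjList (addL gs H) ≡ addL (conjList gs) (conj H)
  conjList-addL []       H = refl
  conjList-addL (g ∷ gs) H = cong₂ _∷_ (conj-+ g H) (conjList-addL gs H)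

  conjList-addR : ∀ G hs → conjList (addR G hs) ≡ addR (conj G) (conjList hs)
  conjList-addR G []       = refl
  conjList-addR G (h ∷ hs) = cong₂ _∷_ (conj-+ G h) (conjList-addR G hs)

mutual
  oL-conj : ∀ G → oL (conj G) ≡ flipO (oR G)
  oL-conj (mk _ [])       = refl
  oL-conj (mk _ (g ∷ gs)) = maxOR-conjList (g ∷ gs)

  oR-conj : ∀ G → oR (conj G) ≡ flipO (oL G)
  oR-conj (mk [] _)       = refl
  oR-conj (mk (g ∷ gs) _) = minOL-conjList (g ∷ gs)

  maxOR-conjList : ∀ gs → maxOR (conjList gs) ≡ flipO (minOL gs)
  maxOR-conjList []       = refl
  maxOR-conjList (g ∷ gs) =
    trans (cong₂ maxO (oR-conj g) (maxOR-conjList gs)) (sym (flipO-minO (oL g) (minOL gs)))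

  minOL-conjList : ∀ gs → minOL (conjList gs) ≡ flipO (maxOR gs)
  minOL-conjList []       = refl
  minOL-conjList (g ∷ gs) =
    trans (cong₂ minO (oL-conj g) (minOL-conjList gs)) (sym (flipO-maxO (oR g) (maxOR gs)))

oR-via-conj : ∀ G H → oR (G +G H) ≡ flipO (oL (conj G +G conj H))
oR-via-conj G H = begin
  oR (G +G H)                        ≡⟨ sym (flipO-involutive (oR (G +G H))) ⟩
  flipO (flipO (oR (G +G H)))        ≡⟨ cong flipO (sym (oL-conj (G +G H))) ⟩
  flipO (oL (conj (G +G H)))         ≡⟨ cong (λ K → flipO (oL K)) (conj-+ G H) ⟩
  flipO (oL (conj G +G conj H))      ∎
  where open ≡-Reasoning

mutual
  rank-conj : ∀ G → rank (conj G) ≡ rank G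
  rank-conj (mk [] [])             = refl
  rank-conj (mk [] (g ∷ gs))       =
    cong suc (trans (⊔-identityʳ (rankList (conjList (g ∷ gs)))) (rankList-conj (g ∷ gs)))
  rank-conj (mk (g ∷ gs) [])       =
    cong suc (trans (rankList-conj (g ∷ gs)) (sym (⊔-identityʳ (rankList (g ∷ gs)))))
  rank-conj (mk (g ∷ gs) (h ∷ hs)) =
    cong suc (trans (cong₂ _⊔_ (rankList-conj (h ∷ hs)) (rankList-conj (g ∷ gs)))
                    (⊔-comm (rankList (h ∷ hs)) (rankList (g ∷ gs))))

  rankList-conj : ∀ gs → rankList (conjList gs) ≡ rankList gs
  rankList-conj []       = refl
  rankList-conj (g ∷ gs) = cong₂ _⊔_ (rank-conj g) (rankList-conj gs)

∈-conjList : g ∈ gs → conj g ∈ conjList gs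
∈-conjList (here refl) = here refl
∈-conjList (there m)   = there (∈-conjList m)

follower-conj : Follower H G → Follower (conj H) (conj G)
follower-conj self       = self
follower-conj (viaL m f) = viaR (∈-conjList m) (follower-conj f)
follower-conj (viaR m f) = viaL (∈-conjList m) (follower-conj f)

follower-of-conj : Follower H (conj G) → Follower (conj H) G
follower-of-conj {G = G} f = subst (Follower _) (conj-involutive G) (follower-conj f)

leftEnd-conj : ∀ G → IsRightEnd G → IsLeftEnd (conj G)
leftEnd-conj (mk _ _) refl = refl

rightEnd-conj : ∀ G → IsLeftEnd G → IsRightEnd (conj G)
rightEnd-conj (mk _ _) refl = refl

deadLeftEnd-conj : DeadRightEnd G → DeadLeftEnd (conj G)
deadLeftEnd-conj dead H f =
  subst IsLeftEnd (conj-involutive H) (leftEnd-conj (conj H) (dead (conj H) (follower-of-conj f)))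

deadRightEnd-conj : DeadLeftEnd G → DeadRightEnd (conj G)
deadRightEnd-conj dead H f =
  subst IsRightEnd (conj-involutive H) (rightEnd-conj (conj H) (dead (conj H) (follower-of-conj f)))

deadEnding-conj : DeadEnding G → DeadEnding (conj G)
deadEnding-conj deadEnding H f with deadEnding (conj H) (follower-of-conj f)
... | deadL , deadR =
  (λ noLeft → subst DeadLeftEnd (conj-involutive H) (deadLeftEnd-conj (deadR (rightEnd-conj H noLeft)))) ,
  (λ noRight → subst DeadRightEnd (conj-involutive H) (deadRightEnd-conj (deadL (leftEnd-conj H noRight))))

strongOutcome-conj : ∀ G o → IsHatOL (conj G) o → IsHatOR G (flipO o)
strongOutcome-conj G o (lowerBound , X , deadEnding , noLeft , eq) =
  upperBound , conj X , deadEnding-conj deadEnding , rightEnd-conj X noLeft , attained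
  where
  upperBound : ∀ Y → DeadEnding Y → IsRightEnd Y → oR (G +G Y) ≤O flipO o
  upperBound Y deadY noRight =
    subst (_≤O flipO o) (sym (oR-via-conj G Y))
      (flipO-antitone (lowerBound (conj Y) (deadEnding-conj deadY) (leftEnd-conj Y noRight)))

  attained : oR (G +G conj X) ≡ flipO o
  attained = begin
    oR (G +G conj X)                      ≡⟨ oR-via-conj G (conj X) ⟩
    flipO (oL (conj G +G conj (conj X)))  ≡⟨ cong (λ K → flipO (oL (conj G +G K))) (conj-involutive X) ⟩
    flipO (oL (conj G +G X))              ≡⟨ cong flipO eq ⟩
    flipO o                               ∎
    where open ≡-Reasoning

mainTheorem3 : (G : Game) → DeadEnding G → 1 ≤ rank G →
    IsHatOL G (minO (oL G) (oL (G +G M (rank G ∸ 1)))) ×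
    IsHatOR G (maxO (oR G) (oR (G +G conj (M (rank G ∸ 1)))))
mainTheorem3 G _ _ =
  strongLeftOutcome G k rankG ,
  subst (IsHatOR G) rightValue
    (strongOutcome-conj G _ (strongLeftOutcome (conj G) k (subst (_≤ suc k) (sym (rank-conj G)) rankG)))
  where
  open ≡-Reasoning

  k : ℕ
  k = rank G ∸ 1

  rankG : rank G ≤ suc k
  rankG = m≤n+m∸n (rank G) 1

  rightValue : flipO (minO (oL (conj G)) (oL (conj G +G M k))) ≡ maxO (oR G) (oR (G +G conj (M k)))
  rightValue = begin
    flipO (minO (oL (conj G)) (oL (conj G +G M k)))
      ≡⟨ flipO-minO (oL (conj G)) (oL (conj G +G M k)) ⟩
    maxO (flipO (oL (conj G))) (flipO (oL (conj G +G M k)))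
      ≡⟨ cong₂ maxO (cong flipO (oL-conj G)) (cong (λ K → flipO (oL (conj G +G K))) (sym (conj-involutive (M k)))) ⟩
    maxO (flipO (flipO (oR G))) (flipO (oL (conj G +G conj (conj (M k)))))
      ≡⟨ cong₂ maxO (flipO-involutive (oR G)) (sym (oR-via-conj G (conj (M k)))) ⟩
    maxO (oR G) (oR (G +G conj (M k)))
      ∎
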